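{- Let $f\colon\{0,\dots,n\}\to\mathbb{Z}$ and $g\colon\{0,\dots,m\}\to\mathbb{Z}$, with $P^-_\delta,P^+_\delta$ as defined in the context. For every $\delta\ge0$, both $P^-_\delta$ and $P^+_\delta$ are monotone paths.
   Context: $\breve f$ is the pointwise maximal convex function $\{0,\dots,n\}\to\mathbb{Q}$ with $\breve f\le f$ (lower convex hull), similarly $\breve g$; $\breve h(k)=\min\{\breve f(i)+\breve g(j):i+j=k,\ 0\le i\le n,\ 0\le j\le m\}$ for $k\in\{0,\dots,n+m\}$. A point is a pair $(i,j)\in\{0,\dots,n\}\times\{0,\dots,m\}$; it lies on diagonal $i+j$. For $\delta\ge0$, $(i,j)$ is $\delta$-relevant if $\breve f(i)+\breve g(j)\le\breve h(i+j)+\delta$. Define $P^+_\delta$ (resp. $P^-_\delta$) as the set of points $(i,k-i)$, over $k\in\{0,\dots,n+m\}$, where $i$ is maximal (resp. minimal) such that $(i,k-i)$ is a $\delta$-relevant point. A set of points $P$ is a monotone path if for every $k\in\{0,\dots,n+m\}$ it contains exactly one point $(i_k,j_k)$ on diagonal $k$, and $(i_{k+1},j_{k+1})\in\{(i_k+1,j_k),(i_k,j_k+1)\}$ for every $k\in\{0,\dots,n+m-1\}$. -}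

module Defs where

open import Data.Nat using (ℕ; suc; _≤_; _+_)
open import Data.Integer using (ℤ)
open import Data.Rational using (ℚ; _/_) renaming (_≤_ to _≤ℚ_; _+_ to _+ℚ_)
open import Data.Product using (Σ; _×_; _,_; proj₁)
import Data.Product
open import Data.Sum using (_⊎_)
open import Relation.Binary.PropositionalEquality using (_≡_)

toℚ : ℤ → ℚ
toℚ z = z / 1

Convex : ℕ → (ℕ → ℚ) → Set
Convex n c = ∀ i → i + 2 ≤ n → c (suc i) +ℚ c (suc i) ≤ℚ c i +ℚ c (suc (suc i))

IsLowerHull : ℕ → (ℕ → ℤ) → (ℕ → ℚ) → Set
IsLowerHull n f fb =
  Convex n fb
  × (∀ i → i ≤ n → fb i ≤ℚ toℚ (f i))
  × (∀ (c : ℕ → ℚ) → Convex n c → (∀ i → i ≤ n → c i ≤ℚ toℚ (f i))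
       → ∀ i → i ≤ n → c i ≤ℚ fb i)

IsMinConv : ℕ → ℕ → (ℕ → ℚ) → (ℕ → ℚ) → (ℕ → ℚ) → Set
IsMinConv n m fb gb hb = ∀ k → k ≤ n + m →
  Σ ℕ (λ i → Σ ℕ (λ j → i + j ≡ k × i ≤ n × j ≤ m × hb k ≡ fb i +ℚ gb j))
  × (∀ i j → i + j ≡ k → i ≤ n → j ≤ m → hb k ≤ℚ fb i +ℚ gb j)

Point : Set
Point = ℕ × ℕ

diag : Point → ℕ
diag (i , j) = i + j

Relevant : ℕ → ℕ → (ℕ → ℚ) → (ℕ → ℚ) → (ℕ → ℚ) → ℚ → Point → Set
Relevant n m fb gb hb δ (i , j) =
  i ≤ n × j ≤ m × fb i +ℚ gb j ≤ℚ hb (i + j) +ℚ δ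

InPplus : ℕ → ℕ → (ℕ → ℚ) → (ℕ → ℚ) → (ℕ → ℚ) → ℚ → Point → Set
InPplus n m fb gb hb δ p =
  Relevant n m fb gb hb δ p
  × (∀ q → diag q ≡ diag p → Relevant n m fb gb hb δ q → Data.Product.proj₁ q ≤ Data.Product.proj₁ p)

InPminus : ℕ → ℕ → (ℕ → ℚ) → (ℕ → ℚ) → (ℕ → ℚ) → ℚ → Point → Set
InPminus n m fb gb hb δ p =
  Relevant n m fb gb hb δ p
  × (∀ q → diag q ≡ diag p → Relevant n m fb gb hb δ q → Data.Product.proj₁ p ≤ Data.Product.proj₁ q)

MonotonePath : ℕ → ℕ → (Point → Set) → Set
MonotonePath n m P =
  (∀ k → k ≤ n + m → Σ Point (λ p → P p × diag p ≡ k))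
  × (∀ p q → P p → P q → diag p ≡ diag q → p ≡ q)
  × (∀ k → suc k ≤ n + m → ∀ i j i' j' → P (i , j) → P (i' , j') → i + j ≡ k → i' + j' ≡ suc k
       → ((i' , j') ≡ (suc i , j)) ⊎ ((i' , j') ≡ (i , suc j)))

{-# OPTIONS --safe #-}
-- If (i , j) is δ-relevant and (p , q) attains h̆ on a neighbouring diagonal, moving (i , j) one
-- step towards (p , q) keeps it δ-relevant: moving (p , q) one step back lands on the diagonal of
-- (i , j), where it costs at least h̆, and by convexity of f̆ and ğ the two moves together do not
-- increase f̆ + ğ. So every relevant point has relevant neighbours on the next diagonal (one step
-- right or up) and on the previous one (one step left or down). Comparing the leftmost (rightmost)
-- relevant points of consecutive diagonals through these neighbours gives i ≤ i′ ≤ i + 1.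

module Submission where

open import Defs
open import Data.Nat using (ℕ; zero; suc; _+_; _∸_; _≤_; _≤′_; z≤n; s≤s; ≤′-refl; ≤′-step; _≤?_)
open import Data.Nat.Properties
  using (≤-refl; ≤-reflexive; ≤-trans; ≤-antisym; <⇒≤; ≰⇒>; ≤⇒≤′; n≤1+n; m≤n⇒m<n∨m≡n; m≤m+n;
         +-mono-≤; +-monoˡ-≤; +-cancelˡ-≤; +-cancelˡ-≡; +-suc; +-comm; suc-injective;
         ∸-monoʳ-≤; m+n∸m≡n; m+[n∸m]≡n; m∸[m∸n]≡n)
open import Data.Integer using (ℤ)
open import Data.Rational using (ℚ; 0ℚ; -_) renaming (_≤_ to _≤ℚ_; _+_ to _+ℚ_)
import Data.Rational.Properties as ℚ
open import Data.Rational.Solver using (module +-*-Solver)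
open import Algebra.Bundles using (CommutativeMonoid)
open import Algebra.Properties.CommutativeSemigroup
  (CommutativeMonoid.commutativeSemigroup ℚ.+-0-commutativeMonoid) using (interchange)
open import Data.Product using (Σ; _×_; _,_; proj₁; proj₂)
open import Data.Sum using (_⊎_; inj₁; inj₂)
open import Relation.Nullary using (yes; no; ¬_; contradiction)
open import Relation.Nullary.Decidable using (_×-dec_)
open import Relation.Unary using (Decidable)
open import Relation.Binary.PropositionalEquality using (_≡_; refl; sym; trans; cong; subst; subst₂)

+-cancelʳ-≤ℚ : ∀ {a b} c → a +ℚ c ≤ℚ b +ℚ c → a ≤ℚ b
+-cancelʳ-≤ℚ {a} {b} c a+c≤b+c = subst₂ _≤ℚ_ (undo a) (undo b) (ℚ.+-monoˡ-≤ (- c) a+c≤b+c)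
  where
  undo : ∀ x → (x +ℚ c) +ℚ - c ≡ x
  undo x = trans (ℚ.+-assoc x c (- c)) (trans (cong (x +ℚ_) (ℚ.+-inverseʳ c)) (ℚ.+-identityʳ x))

slack-transfer : ∀ {a a′ b b′ c δ} → a′ +ℚ b′ ≤ℚ a +ℚ b → a ≤ℚ c +ℚ δ → c ≤ℚ b′ → a′ ≤ℚ b +ℚ δ
slack-transfer {a} {a′} {b} {b′} {c} {δ} exchange a≤c+δ c≤b′ = +-cancelʳ-≤ℚ b′ (begin
  a′ +ℚ b′         ≤⟨ exchange ⟩
  a +ℚ b           ≤⟨ ℚ.+-monoˡ-≤ b (ℚ.≤-trans a≤c+δ (ℚ.+-monoˡ-≤ δ c≤b′)) ⟩
  (b′ +ℚ δ) +ℚ b   ≡⟨ solve 3 (λ b b′ δ → (b′ :+ δ) :+ b := (b :+ δ) :+ b′) refl b b′ δ ⟩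
  (b +ℚ δ) +ℚ b′   ∎)
  where open ℚ.≤-Reasoning; open +-*-Solver

+-comm-≤ℚ : ∀ a b c d → a +ℚ b ≤ℚ c +ℚ d → b +ℚ a ≤ℚ d +ℚ c
+-comm-≤ℚ a b c d = subst₂ _≤ℚ_ (ℚ.+-comm a b) (ℚ.+-comm c d)

convex-exchange : ∀ {N} c → Convex N c → ∀ {x y} → x ≤ y → suc y ≤ N
                → c (suc x) +ℚ c y ≤ℚ c x +ℚ c (suc y)
convex-exchange {N} c convex {x} x≤y = go (≤⇒≤′ x≤y)
  where
  go : ∀ {y} → x ≤′ y → suc y ≤ N → c (suc x) +ℚ c y ≤ℚ c x +ℚ c (suc y)
  go ≤′-refl _ = ℚ.≤-reflexive (ℚ.+-comm (c (suc x)) (c x))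
  go (≤′-step {y} x≤′y) y+2≤N = +-cancelʳ-≤ℚ (c y +ℚ c (suc y)) (begin
    (c (suc x) +ℚ c (suc y)) +ℚ (c y +ℚ c (suc y))
      ≡⟨ interchange (c (suc x)) (c (suc y)) (c y) (c (suc y)) ⟩
    (c (suc x) +ℚ c y) +ℚ (c (suc y) +ℚ c (suc y))
      ≤⟨ ℚ.+-mono-≤ (go x≤′y (<⇒≤ y+2≤N)) (convex y (subst (_≤ N) (+-comm 2 y) y+2≤N)) ⟩
    (c x +ℚ c (suc y)) +ℚ (c y +ℚ c (suc (suc y)))
      ≡⟨ solve 4 (λ p d b e → (p :+ d) :+ (b :+ e) := (p :+ e) :+ (b :+ d)) refl
           (c x) (c (suc y)) (c y) (c (suc (suc y))) ⟩
    (c x +ℚ c (suc (suc y))) +ℚ (c y +ℚ c (suc y)) ∎)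
    where open ℚ.≤-Reasoning; open +-*-Solver

m+n≡o+p∧o≤m⇒n≤p : ∀ {m n o p} → m + n ≡ o + p → o ≤ m → n ≤ p
m+n≡o+p∧o≤m⇒n≤p {m} {n} {o} {p} eq o≤m =
  +-cancelˡ-≤ o n p (≤-trans (+-monoˡ-≤ n o≤m) (≤-reflexive eq))

diagonal-split : ∀ {p q i j} → p + q ≡ suc (i + j)
               → (Σ ℕ λ q′ → q ≡ suc q′ × j ≤ q′ × p + q′ ≡ i + j)
               ⊎ (Σ ℕ λ p′ → p ≡ suc p′ × i ≤ p′ × p′ + q ≡ i + j)
diagonal-split {p} {q} {i} {j} eq with p ≤? i
... | yes p≤i with m+n≡o+p∧o≤m⇒n≤p (trans (+-suc i j) (sym eq)) p≤i
...   | s≤s {n = q′} j≤q′ = inj₁ (q′ , refl , j≤q′ , suc-injective (trans (sym (+-suc p q′)) eq))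
diagonal-split {p} {q} {i} {j} eq | no p≰i with ≰⇒> p≰i
...   | s≤s {n = p′} i≤p′ = inj₂ (p′ , refl , i≤p′ , suc-injective eq)

least-or-none : ∀ {P : ℕ → Set} → Decidable P → ∀ k
              → (Σ ℕ λ i → P i × ∀ {j} → P j → i ≤ j) ⊎ (∀ {j} → j ≤ k → ¬ P j)
least-or-none P? zero with P? zero
... | yes p0 = inj₁ (zero , p0 , λ _ → z≤n)
... | no ¬p0 = inj₂ λ { z≤n → ¬p0 }
least-or-none P? (suc k) with least-or-none P? k | P? (suc k)
... | inj₁ found | _      = inj₁ found
... | inj₂ none  | yes pk = inj₁ (suc k , pk , λ pj → ≰⇒> λ j≤k → none j≤k pj)
least-or-none {P} P? (suc k) | inj₂ none | no ¬pk = inj₂ none′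
  where
  none′ : ∀ {j} → j ≤ suc k → ¬ P j
  none′ j≤1+k with m≤n⇒m<n∨m≡n j≤1+k
  ... | inj₁ (s≤s j≤k) = none j≤k
  ... | inj₂ refl      = ¬pk

least : ∀ {P : ℕ → Set} → Decidable P → ∀ {k} → P k → Σ ℕ λ i → P i × ∀ {j} → P j → i ≤ j
least P? {k} pk with least-or-none P? k
... | inj₁ found = found
... | inj₂ none  = contradiction pk (none ≤-refl)

-- The largest witness below k is k ∸ i for the least i with P (k ∸ i).
greatest : ∀ {P : ℕ → Set} → Decidable P → ∀ {k} → (∀ {i} → P i → i ≤ k)
         → ∀ {x} → P x → Σ ℕ λ i → P i × ∀ {j} → P j → j ≤ i
greatest {P} P? {k} bounded {x} px = reflected (least (λ i → P? (k ∸ i)) {k ∸ x} (reflect px))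
  where
  reflect : ∀ {j} → P j → P (k ∸ (k ∸ j))
  reflect pj = subst P (sym (m∸[m∸n]≡n (bounded pj))) pj

  reflected : (Σ ℕ λ i → P (k ∸ i) × ∀ {j} → P (k ∸ j) → i ≤ j) → Σ ℕ λ i → P i × ∀ {j} → P j → j ≤ i
  reflected (y , py , y-least) =
    k ∸ y , py ,
    λ {j} pj → subst (_≤ k ∸ y) (m∸[m∸n]≡n (bounded pj)) (∸-monoʳ-≤ k (y-least {k ∸ j} (reflect pj)))

Adjacent : Point → Point → Set
Adjacent (i , j) (i′ , j′) = i′ + j′ ≡ suc (i + j) × i ≤ i′ × i′ ≤ suc i

adjacent⇒step : ∀ {i j i′ j′} → Adjacent (i , j) (i′ , j′)
              → (i′ , j′) ≡ (suc i , j) ⊎ (i′ , j′) ≡ (i , suc j)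
adjacent⇒step {i} {j} {i′} {j′} (diag≡ , i≤i′ , i′≤1+i) with m≤n⇒m<n∨m≡n i≤i′
... | inj₂ refl = inj₂ (cong (i ,_) (+-cancelˡ-≡ i j′ (suc j) (trans diag≡ (sym (+-suc i j)))))
... | inj₁ i<i′ with ≤-antisym i′≤1+i i<i′
...   | refl = inj₁ (cong (suc i ,_) (+-cancelˡ-≡ (suc i) j′ j diag≡))

≡-on-diagonal : ∀ {p q : Point} → diag p ≡ diag q → proj₁ p ≡ proj₁ q → p ≡ q
≡-on-diagonal {i , j} {.i , j′} diag≡ refl = cong (i ,_) (+-cancelˡ-≡ i j j′ diag≡)

Leftmost : (Point → Set) → Point → Set
Leftmost R p = R p × (∀ q → diag q ≡ diag p → R q → proj₁ p ≤ proj₁ q)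

Rightmost : (Point → Set) → Point → Set
Rightmost R p = R p × (∀ q → diag q ≡ diag p → R q → proj₁ q ≤ proj₁ p)

module ExtremalPaths
  (n m : ℕ) {R : Point → Set} (R? : Decidable R)
  (inhabited : ∀ k → k ≤ n + m → Σ Point λ p → R p × diag p ≡ k)
  (forward : ∀ {p} → R p → suc (diag p) ≤ n + m → Σ Point λ q → R q × Adjacent p q)
  (backward : ∀ {q k} → R q → diag q ≡ suc k → Σ Point λ p → R p × Adjacent p q)
  where

  OnDiagonal : ℕ → ℕ → Set
  OnDiagonal k i = i ≤ k × R (i , k ∸ i)

  onDiagonal? : ∀ k → Decidable (OnDiagonal k)
  onDiagonal? k i = i ≤? k ×-dec R? (i , k ∸ i)

  onDiagonal : ∀ {i j k} → R (i , j) → i + j ≡ k → OnDiagonal k i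
  onDiagonal {i} {j} r refl = m≤m+n i j , subst (λ t → R (i , t)) (sym (m+n∸m≡n i j)) r

  onDiagonal-diag : ∀ {k i} → OnDiagonal k i → i + (k ∸ i) ≡ k
  onDiagonal-diag (i≤k , _) = m+[n∸m]≡n i≤k

  leftmost-exists : ∀ k → k ≤ n + m → Σ Point λ p → Leftmost R p × diag p ≡ k
  leftmost-exists k k≤n+m with inhabited k k≤n+m
  ... | _ , r , diag≡ with least (onDiagonal? k) (onDiagonal r diag≡)
  ... | i , i-on , i-least =
    (i , k ∸ i) ,
    (proj₂ i-on , λ q q≡ rq → i-least (onDiagonal rq (trans q≡ (onDiagonal-diag i-on)))) ,
    onDiagonal-diag i-on

  rightmost-exists : ∀ k → k ≤ n + m → Σ Point λ p → Rightmost R p × diag p ≡ k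
  rightmost-exists k k≤n+m with inhabited k k≤n+m
  ... | _ , r , diag≡ with greatest (onDiagonal? k) proj₁ (onDiagonal r diag≡)
  ... | i , i-on , i-greatest =
    (i , k ∸ i) ,
    (proj₂ i-on , λ q q≡ rq → i-greatest (onDiagonal rq (trans q≡ (onDiagonal-diag i-on)))) ,
    onDiagonal-diag i-on

  leftmost-adjacent : ∀ {p p′} → Leftmost R p → Leftmost R p′
                    → diag p′ ≡ suc (diag p) → suc (diag p) ≤ n + m → Adjacent p p′
  leftmost-adjacent {p} {p′} (rp , p-least) (rp′ , p′-least) diag≡ k<n+m = diag≡ , p≤p′ , p′≤1+p
    where
    p≤p′ : proj₁ p ≤ proj₁ p′
    p≤p′ with backward rp′ diag≡
    ... | q , rq , q≡ , q≤p′ , _ = ≤-trans (p-least q (suc-injective (trans (sym q≡) diag≡)) rq) q≤p′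

    p′≤1+p : proj₁ p′ ≤ suc (proj₁ p)
    p′≤1+p with forward rp k<n+m
    ... | q , rq , q≡ , _ , q≤1+p = ≤-trans (p′-least q (trans q≡ (sym diag≡)) rq) q≤1+p

  rightmost-adjacent : ∀ {p p′} → Rightmost R p → Rightmost R p′
                     → diag p′ ≡ suc (diag p) → suc (diag p) ≤ n + m → Adjacent p p′
  rightmost-adjacent {p} {p′} (rp , p-greatest) (rp′ , p′-greatest) diag≡ k<n+m = diag≡ , p≤p′ , p′≤1+p
    where
    p≤p′ : proj₁ p ≤ proj₁ p′
    p≤p′ with forward rp k<n+m
    ... | q , rq , q≡ , p≤q , _ = ≤-trans p≤q (p′-greatest q (trans q≡ (sym diag≡)) rq)

    p′≤1+p : proj₁ p′ ≤ suc (proj₁ p)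
    p′≤1+p with backward rp′ diag≡
    ... | q , rq , q≡ , _ , p′≤1+q =
      ≤-trans p′≤1+q (s≤s (p-greatest q (suc-injective (trans (sym q≡) diag≡)) rq))

  leftmost-path : MonotonePath n m (Leftmost R)
  leftmost-path = leftmost-exists , unique , step
    where
    unique : ∀ p q → Leftmost R p → Leftmost R q → diag p ≡ diag q → p ≡ q
    unique p q (rp , p-least) (rq , q-least) diag≡ =
      ≡-on-diagonal diag≡ (≤-antisym (p-least q (sym diag≡) rq) (q-least p diag≡ rp))

    step : ∀ k → suc k ≤ n + m → ∀ i j i′ j′ → Leftmost R (i , j) → Leftmost R (i′ , j′)
         → i + j ≡ k → i′ + j′ ≡ suc k → (i′ , j′) ≡ (suc i , j) ⊎ (i′ , j′) ≡ (i , suc j)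
    step k k<n+m i j i′ j′ lp lp′ refl diag≡ = adjacent⇒step (leftmost-adjacent lp lp′ diag≡ k<n+m)

  rightmost-path : MonotonePath n m (Rightmost R)
  rightmost-path = rightmost-exists , unique , step
    where
    unique : ∀ p q → Rightmost R p → Rightmost R q → diag p ≡ diag q → p ≡ q
    unique p q (rp , p-greatest) (rq , q-greatest) diag≡ =
      ≡-on-diagonal diag≡ (≤-antisym (q-greatest p diag≡ rp) (p-greatest q (sym diag≡) rq))

    step : ∀ k → suc k ≤ n + m → ∀ i j i′ j′ → Rightmost R (i , j) → Rightmost R (i′ , j′)
         → i + j ≡ k → i′ + j′ ≡ suc k → (i′ , j′) ≡ (suc i , j) ⊎ (i′ , j′) ≡ (i , suc j)
    step k k<n+m i j i′ j′ rp rp′ refl diag≡ = adjacent⇒step (rightmost-adjacent rp rp′ diag≡ k<n+m)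

module Relevance
  {n m : ℕ} {fb gb hb : ℕ → ℚ} (fb-convex : Convex n fb) (gb-convex : Convex m gb)
  (hb-minConv : IsMinConv n m fb gb hb) (δ : ℚ)
  where

  Relevantδ : Point → Set
  Relevantδ = Relevant n m fb gb hb δ

  F : Point → ℚ
  F (i , j) = fb i +ℚ gb j

  relevant? : Decidable Relevantδ
  relevant? (i , j) = i ≤? n ×-dec j ≤? m ×-dec F (i , j) ℚ.≤? hb (i + j) +ℚ δ

  hb≤F : ∀ {i j k} → i ≤ n → j ≤ m → i + j ≡ k → hb k ≤ℚ F (i , j)
  hb≤F i≤n j≤m refl = proj₂ (hb-minConv _ (+-mono-≤ i≤n j≤m)) _ _ refl i≤n j≤m

  exchangeʲ : ∀ i p {x y} → x ≤ y → suc y ≤ m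
            → F (i , suc x) +ℚ F (p , y) ≤ℚ F (i , x) +ℚ F (p , suc y)
  exchangeʲ i p {x} {y} x≤y y<m =
    subst₂ _≤ℚ_ (interchange (fb i) (fb p) (gb (suc x)) (gb y))
                (interchange (fb i) (fb p) (gb x) (gb (suc y)))
      (ℚ.+-monoʳ-≤ (fb i +ℚ fb p) (convex-exchange gb gb-convex x≤y y<m))

  exchangeⁱ : ∀ j q {x y} → x ≤ y → suc y ≤ n
            → F (suc x , j) +ℚ F (y , q) ≤ℚ F (x , j) +ℚ F (suc y , q)
  exchangeⁱ j q {x} {y} x≤y y<n =
    subst₂ _≤ℚ_ (interchange (fb (suc x)) (fb y) (gb j) (gb q))
                (interchange (fb x) (fb (suc y)) (gb j) (gb q))
      (ℚ.+-monoˡ-≤ (gb j +ℚ gb q) (convex-exchange fb fb-convex x≤y y<n))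

  exchangeʲ′ : ∀ i p {x y} → x ≤ y → suc y ≤ m
             → F (i , y) +ℚ F (p , suc x) ≤ℚ F (i , suc y) +ℚ F (p , x)
  exchangeʲ′ i p {x} {y} x≤y y<m =
    +-comm-≤ℚ (F (p , suc x)) (F (i , y)) (F (p , x)) (F (i , suc y)) (exchangeʲ p i x≤y y<m)

  exchangeⁱ′ : ∀ j q {x y} → x ≤ y → suc y ≤ n
             → F (y , j) +ℚ F (suc x , q) ≤ℚ F (suc y , j) +ℚ F (x , q)
  exchangeⁱ′ j q {x} {y} x≤y y<n =
    +-comm-≤ℚ (F (suc x , q)) (F (y , j)) (F (x , q)) (F (suc y , j)) (exchangeⁱ q j x≤y y<n)

  -- Trading one unit between the relevant point r and the optimal point o of the neighbouring
  -- diagonal (r ↦ r′, o ↦ c) does not increase the total cost, so r′ inherits the slack δ of r.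
  relevant-transfer : ∀ {k} r c o r′
    → Relevantδ r → proj₁ c ≤ n → proj₂ c ≤ m → diag c ≡ diag r
    → hb k ≡ F o → proj₁ r′ ≤ n → proj₂ r′ ≤ m → diag r′ ≡ k
    → F r′ +ℚ F c ≤ℚ F r +ℚ F o → Relevantδ r′
  relevant-transfer _ _ _ _ (_ , _ , relevant) c₁≤n c₂≤m c≡ optimal r′₁≤n r′₂≤m refl exchange =
    r′₁≤n , r′₂≤m ,
    subst (λ h → _ ≤ℚ h +ℚ δ) (sym optimal) (slack-transfer exchange relevant (hb≤F c₁≤n c₂≤m c≡))

  relevant-inhabited : 0ℚ ≤ℚ δ → ∀ k → k ≤ n + m → Σ Point λ p → Relevantδ p × diag p ≡ k
  relevant-inhabited 0≤δ k k≤n+m with proj₁ (hb-minConv k k≤n+m)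
  ... | i , j , refl , i≤n , j≤m , optimal =
    (i , j) , (i≤n , j≤m , subst (λ h → F (i , j) ≤ℚ h +ℚ δ) (sym optimal) F≤F+δ) , refl
    where
    F≤F+δ : F (i , j) ≤ℚ F (i , j) +ℚ δ
    F≤F+δ = subst (_≤ℚ F (i , j) +ℚ δ) (ℚ.+-identityʳ (F (i , j))) (ℚ.+-monoʳ-≤ (F (i , j)) 0≤δ)

  relevant-forward : ∀ {p} → Relevantδ p → suc (diag p) ≤ n + m
                   → Σ Point λ q → Relevantδ q × Adjacent p q
  relevant-forward {i , j} rel@(i≤n , j≤m , _) k<n+m with proj₁ (hb-minConv _ k<n+m)
  ... | p , q , pq≡ , p≤n , q≤m , optimal with diagonal-split {p} {q} {i} {j} pq≡
  ... | inj₁ (q′ , refl , j≤q′ , pq′≡) =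
    (i , suc j) ,
    relevant-transfer (i , j) (p , q′) (p , suc q′) (i , suc j) rel
      p≤n (<⇒≤ q≤m) pq′≡
      optimal i≤n (≤-trans (s≤s j≤q′) q≤m) (+-suc i j)
      (exchangeʲ i p j≤q′ q≤m) ,
    +-suc i j , ≤-refl , n≤1+n i
  ... | inj₂ (p′ , refl , i≤p′ , p′q≡) =
    (suc i , j) ,
    relevant-transfer (i , j) (p′ , q) (suc p′ , q) (suc i , j) rel
      (<⇒≤ p≤n) q≤m p′q≡
      optimal (≤-trans (s≤s i≤p′) p≤n) j≤m refl
      (exchangeⁱ j q i≤p′ p≤n) ,
    refl , n≤1+n i , ≤-refl

  relevant-backward : ∀ {q k} → Relevantδ q → diag q ≡ suc k
                    → Σ Point λ p → Relevantδ p × Adjacent p q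
  relevant-backward {i , j} {k} rel@(i≤n , j≤m , _) ij≡ with proj₁ (hb-minConv k k≤n+m)
    where
    k≤n+m : k ≤ n + m
    k≤n+m = ≤-trans (n≤1+n k) (subst (_≤ n + m) ij≡ (+-mono-≤ i≤n j≤m))
  ... | p , q , pq≡ , p≤n , q≤m , optimal
          with diagonal-split {i} {j} {p} {q} (trans ij≡ (cong suc (sym pq≡)))
  ... | inj₁ (j′ , refl , q≤j′ , ij′≡) =
    (i , j′) ,
    relevant-transfer (i , suc j′) (p , suc q) (p , q) (i , j′) rel
      p≤n (≤-trans (s≤s q≤j′) j≤m) (trans (+-suc p q) (trans (cong suc (sym ij′≡)) (sym (+-suc i j′))))
      optimal i≤n (<⇒≤ j≤m) (trans ij′≡ pq≡)
      (exchangeʲ′ i p q≤j′ j≤m) ,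
    +-suc i j′ , ≤-refl , n≤1+n i
  ... | inj₂ (i′ , refl , p≤i′ , i′j≡) =
    (i′ , j) ,
    relevant-transfer (suc i′ , j) (suc p , q) (p , q) (i′ , j) rel
      (≤-trans (s≤s p≤i′) i≤n) q≤m (cong suc (sym i′j≡))
      optimal (<⇒≤ i≤n) j≤m (trans i′j≡ pq≡)
      (exchangeⁱ′ j q p≤i′ i≤n) ,
    refl , n≤1+n i′ , ≤-refl

lemma4p2 : (n m : ℕ) (f g : ℕ → ℤ) (fb gb hb : ℕ → ℚ)
           → IsLowerHull n f fb → IsLowerHull m g gb → IsMinConv n m fb gb hb
           → (δ : ℚ) → 0ℚ ≤ℚ δ
           → MonotonePath n m (InPminus n m fb gb hb δ)
             × MonotonePath n m (InPplus n m fb gb hb δ)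
lemma4p2 n m f g fb gb hb (fb-convex , _) (gb-convex , _) hb-minConv δ 0≤δ =
  leftmost-path , rightmost-path
  where
  open Relevance {fb = fb} {gb = gb} fb-convex gb-convex hb-minConv δ
  open ExtremalPaths n m relevant? (relevant-inhabited 0≤δ) relevant-forward relevant-backward
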